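{- Let $p>2$ be a prime and $r>1$ an integer with $r\equiv1\pmod{p-1}$, and put $t=v(r-1)$. Then (1) $\sum_{\mu\in\mathbb{F}_p}(1+[\mu])^r\equiv rp\pmod{p^{t+2}}$, and (2) $\sum_{\mu\in\mathbb{F}_p}(1+[\mu])^{r-1}\equiv p-1\pmod{p^{t+1}}$.
   Context: $v$ is the $p$-adic valuation with $v(p)=1$; for $\mu\in\mathbb{F}_p$, $[\mu]\in\mathbb{Z}_p$ denotes its Teichmüller lift; congruences are in $\mathbb{Z}_p$. -}

module Defs where

open import Data.Nat as ℕ using (ℕ; zero; suc)
open import Data.Fin using (Fin; toℕ)
import Data.Nat.Divisibility as ℕD
open import Data.Integer as ℤ using (ℤ; +_; _-_; _+_; _^_)
open import Data.Integer.Divisibility using (_∣_)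
open import Relation.Nullary using (¬_)
open import Data.Product using (_×_)

infix 4 _≡_[mod_]
_≡_[mod_] : ℤ → ℤ → ℕ → Set
a ≡ b [mod m ] = (+ m) ∣ (a - b)

IsValuation : ℕ → ℕ → ℕ → Set
IsValuation p n t = (p ℕ.^ t) ℕD.∣ n × ¬ ((p ℕ.^ suc t) ℕD.∣ n)

-- sum over μ ∈ F_p ≅ Fin p
sumFin : (n : ℕ) → (Fin n → ℤ) → ℤ
sumFin zero f = + 0
sumFin (suc n) f = f Fin.zero + sumFin n (λ i → f (Fin.suc i))

-- a is (an integer representative of) the Teichmüller lift of μ ∈ F_p
-- modulo p^N :  a ≡ μ (mod p)  and  a^p ≡ a (mod p^N).
-- Such a is unique mod p^N and equals [μ] mod p^N.
IsTeichLiftMod : (p N : ℕ) → Fin p → ℤ → Set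
IsTeichLiftMod p N μ a = (a ≡ + toℕ μ [mod p ]) × (a ^ p ≡ a [mod p ℕ.^ N ])

{-# OPTIONS --safe #-}
module Submission where

-- Write x μ = 1 + [μ] and r − 1 = (p − 1) p^t m. For μ ≠ −1, x μ is a p-adic unit and
-- u = (x μ)^(p−1) ≡ 1 (mod p); the binomial theorem, with p ∣ (p choose 2) as p is odd,
-- lifts this to u^(p^t m) ≡ 1 + p^t m (u − 1) (mod p^(t+2)). Hence
-- (x μ)^r ≡ x μ + p^t m ((x μ)^p − x μ) (mod p^(t+2)) and (x μ)^(r−1) ≡ 1 (mod p^(t+1)),
-- while x (−1) ≡ 0. Summing: Σ x μ = p + Σ [μ] ≡ p since [−μ] = −[μ], and
-- Σ (x μ)^p ≡ Σ [μ + 1] ≡ 0 (mod p²) since x μ ≡ [μ + 1] (mod p). So Σ (x μ)^r ≡ p − p^(t+1) m,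
-- which is r p modulo p^(t+2), and Σ (x μ)^(r−1) ≡ p − 1 (mod p^(t+1)). The lifts are only
-- given modulo p^(t+2); the identities between them used above follow from their uniqueness.

module _ where
  open import Data.Nat as ℕ using (ℕ; zero; suc; _≤_; _<_; _∸_; z≤n; s≤s)
  import Data.Nat.Properties as ℕ
  import Data.Nat.Divisibility as ℕ
  import Data.Nat.Tactic.RingSolver as ℕ using (solve-∀)
  open import Data.Nat.Combinatorics using (_C_; nC1≡n; nCk+nC[k+1]≡[n+1]C[k+1])
  open import Data.Nat.DivMod using (_%_; _/_; m%n<n; m≡m%n+[m/n]*n)
  open import Data.Nat.Primality using (Prime; euclidsLemma; prime⇒nonZero; prime⇒irreducible)
  open import Data.Integer as ℤ using (ℤ; +_; -_; _+_; _-_; _*_; _^_; ∣_∣)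
  import Data.Integer.Properties as ℤ
  import Data.Integer.Divisibility.Signed as ℤ
  open import Data.Integer.Tactic.RingSolver using (solve-∀)
  open import Data.Fin using (Fin; toℕ; inject₁; fromℕ; opposite)
  import Data.Fin as F using (zero; suc)
  open import Data.Fin.Properties using (toℕ-fromℕ; toℕ-inject₁; toℕ<n; opposite-prop)
  import Data.Fin.Permutation as Perm using (reverse)
  open import Algebra.Properties.CommutativeMonoid.Sum ℤ.+-0-commutativeMonoid
    using (sum; sum-init-last; sum-permute; ∑-distrib-+)
  open import Data.Product using (Σ; _,_; proj₁; proj₂)
  open import Data.Sum using (_⊎_; inj₁; inj₂)
  open import Function using (_∘_)
  open import Level using (0ℓ)
  open import Relation.Binary.Bundles using (Setoid)
  open import Relation.Binary.PropositionalEquality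
  open import Relation.Nullary using (¬_; contradiction)
  open import Defs using (_≡_[mod_]; sumFin; IsTeichLiftMod)

  -- Unlike _≡_[mod_], which unfolds to ℕ-divisibility of ∣ a - b ∣, a record keeps
  -- a, b and m inferable by unification.
  infix 4 _≡_⟨mod_⟩
  record _≡_⟨mod_⟩ (a b m : ℤ) : Set where
    constructor mod-intro
    field
      divides-difference : m ℤ.∣ a - b

  open _≡_⟨mod_⟩

  ⟨mod⟩⇒[mod] : ∀ {a b m} → a ≡ b ⟨mod + m ⟩ → a ≡ b [mod m ]
  ⟨mod⟩⇒[mod] a≡b = ℤ.∣⇒∣ᵤ (divides-difference a≡b)

  [mod]⇒⟨mod⟩ : ∀ {a b m} → a ≡ b [mod m ] → a ≡ b ⟨mod + m ⟩
  [mod]⇒⟨mod⟩ a≡b = mod-intro (ℤ.∣ᵤ⇒∣ a≡b)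

  pos-^ : ∀ p k → + (p ℕ.^ k) ≡ (+ p) ^ k
  pos-^ p zero    = refl
  pos-^ p (suc k) = trans (ℤ.pos-* p (p ℕ.^ k)) (cong (+ p *_) (pos-^ p k))

  module _ {m : ℤ} where

    mod-from : ∀ {x a b} → m ℤ.∣ x → x ≡ a - b → a ≡ b ⟨mod m ⟩
    mod-from m∣x refl = mod-intro m∣x

    mod-reflexive : ∀ {a b} → a ≡ b → a ≡ b ⟨mod m ⟩
    mod-reflexive {a} refl = mod-from (ℤ.∣ᵤ⇒∣ (∣ m ∣ ℕ.∣0)) (sym (ℤ.+-inverseʳ a))

    mod-refl : ∀ {a} → a ≡ a ⟨mod m ⟩
    mod-refl = mod-reflexive refl

    mod-sym : ∀ {a b} → a ≡ b ⟨mod m ⟩ → b ≡ a ⟨mod m ⟩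
    mod-sym {a} {b} (mod-intro m∣a-b) = mod-from (ℤ.∣m⇒∣-m m∣a-b) (swap a b)
      where
      swap : ∀ a b → - (a - b) ≡ b - a
      swap = solve-∀

    mod-trans : ∀ {a b c} → a ≡ b ⟨mod m ⟩ → b ≡ c ⟨mod m ⟩ → a ≡ c ⟨mod m ⟩
    mod-trans {a} {b} {c} (mod-intro m∣a-b) (mod-intro m∣b-c) =
      mod-from (ℤ.∣m∣n⇒∣m+n m∣a-b m∣b-c) (telescope a b c)
      where
      telescope : ∀ a b c → (a - b) + (b - c) ≡ a - c
      telescope = solve-∀

    mod-+-cong : ∀ {a b c d} → a ≡ b ⟨mod m ⟩ → c ≡ d ⟨mod m ⟩ → a + c ≡ b + d ⟨mod m ⟩
    mod-+-cong {a} {b} {c} {d} (mod-intro m∣a-b) (mod-intro m∣c-d) =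
      mod-from (ℤ.∣m∣n⇒∣m+n m∣a-b m∣c-d) (regroup a b c d)
      where
      regroup : ∀ a b c d → (a - b) + (c - d) ≡ (a + c) - (b + d)
      regroup = solve-∀

    mod-neg-cong : ∀ {a b} → a ≡ b ⟨mod m ⟩ → - a ≡ - b ⟨mod m ⟩
    mod-neg-cong {a} {b} (mod-intro m∣a-b) = mod-from (ℤ.∣m⇒∣-m m∣a-b) (regroup a b)
      where
      regroup : ∀ a b → - (a - b) ≡ - a - - b
      regroup = solve-∀

    mod---cong : ∀ {a b c d} → a ≡ b ⟨mod m ⟩ → c ≡ d ⟨mod m ⟩ → a - c ≡ b - d ⟨mod m ⟩
    mod---cong a≡b c≡d = mod-+-cong a≡b (mod-neg-cong c≡d)

    mod-*-cong : ∀ {a b c d} → a ≡ b ⟨mod m ⟩ → c ≡ d ⟨mod m ⟩ → a * c ≡ b * d ⟨mod m ⟩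
    mod-*-cong {a} {b} {c} {d} (mod-intro m∣a-b) (mod-intro m∣c-d) =
      mod-from (ℤ.∣m∣n⇒∣m+n (ℤ.∣m⇒∣m*n c m∣a-b) (ℤ.∣n⇒∣m*n b m∣c-d)) (regroup a b c d)
      where
      regroup : ∀ a b c d → (a - b) * c + b * (c - d) ≡ a * c - b * d
      regroup = solve-∀

    mod-+-congˡ : ∀ c {a b} → a ≡ b ⟨mod m ⟩ → c + a ≡ c + b ⟨mod m ⟩
    mod-+-congˡ c = mod-+-cong (mod-refl {c})

    mod-+-congʳ : ∀ c {a b} → a ≡ b ⟨mod m ⟩ → a + c ≡ b + c ⟨mod m ⟩
    mod-+-congʳ c a≡b = mod-+-cong a≡b (mod-refl {c})

    mod-*-congˡ : ∀ c {a b} → a ≡ b ⟨mod m ⟩ → c * a ≡ c * b ⟨mod m ⟩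
    mod-*-congˡ c = mod-*-cong (mod-refl {c})

    mod-^-cong : ∀ {a b} k → a ≡ b ⟨mod m ⟩ → a ^ k ≡ b ^ k ⟨mod m ⟩
    mod-^-cong zero    a≡b = mod-refl
    mod-^-cong (suc k) a≡b = mod-*-cong a≡b (mod-^-cong k a≡b)

    mod-setoid : Setoid 0ℓ 0ℓ
    mod-setoid = record
      { Carrier       = ℤ
      ; _≈_           = _≡_⟨mod m ⟩
      ; isEquivalence = record { refl = mod-refl ; sym = mod-sym ; trans = mod-trans }
      }

  mod-weaken : ∀ {m n a b} → m ℤ.∣ n → a ≡ b ⟨mod n ⟩ → a ≡ b ⟨mod m ⟩
  mod-weaken m∣n (mod-intro n∣a-b) = mod-intro (ℤ.∣-trans m∣n n∣a-b)

  mod-scale : ∀ {m a b} k → a ≡ b ⟨mod m ⟩ → k * a ≡ k * b ⟨mod k * m ⟩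
  mod-scale {m} {a} {b} k (mod-intro m∣a-b) = mod-from (ℤ.*-monoʳ-∣ k m∣a-b) (regroup k a b)
    where
    regroup : ∀ k a b → k * (a - b) ≡ k * a - k * b
    regroup = solve-∀

  mod-+-∣ : ∀ {m x a} → m ℤ.∣ x → a + x ≡ a ⟨mod m ⟩
  mod-+-∣ {x = x} {a} m∣x = mod-from m∣x (cancel a x)
    where
    cancel : ∀ a x → x ≡ a + x - a
    cancel = solve-∀

  m∣m*n : ∀ m n → m ℤ.∣ m * n
  m∣m*n m n = ℤ.∣m⇒∣m*n n ℤ.∣-refl

  module ModReasoning (m : ℤ) where
    open import Relation.Binary.Reasoning.Setoid (mod-setoid {m}) public

  *-pres-∣ : ∀ {i j m n} → i ℤ.∣ m → j ℤ.∣ n → i * j ℤ.∣ m * n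
  *-pres-∣ {j = j} {m} i∣m j∣n = ℤ.∣-trans (ℤ.*-monoˡ-∣ j i∣m) (ℤ.*-monoʳ-∣ m j∣n)

  ^-monoʳ-∣ : ∀ a {j k} → j ≤ k → a ^ j ℤ.∣ a ^ k
  ^-monoʳ-∣ a {j} {k} j≤k = subst (λ e → a ^ j ℤ.∣ a ^ e) (ℕ.m+[n∸m]≡n j≤k)
    (subst (a ^ j ℤ.∣_) (sym (ℤ.^-distribˡ-+-* a j (k ∸ j))) (m∣m*n (a ^ j) (a ^ (k ∸ j))))

  euclidsLemmaℤ : ∀ {p} a b → Prime p → + p ℤ.∣ a * b → + p ℤ.∣ a ⊎ + p ℤ.∣ b
  euclidsLemmaℤ a b pp p∣ab
    with euclidsLemma ∣ a ∣ ∣ b ∣ pp (subst (_ ℕ.∣_) (ℤ.abs-* a b) (ℤ.∣⇒∣ᵤ p∣ab))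
  ... | inj₁ p∣a = inj₁ (ℤ.∣ᵤ⇒∣ p∣a)
  ... | inj₂ p∣b = inj₂ (ℤ.∣ᵤ⇒∣ p∣b)

  prime^∣-cancelˡ : ∀ {p} a {b} → Prime p → ¬ (+ p ℤ.∣ a) →
                    ∀ j → (+ p) ^ j ℤ.∣ a * b → (+ p) ^ j ℤ.∣ b
  prime^∣-cancelˡ     a {b} pp p∤a zero    _ = ℤ.∣ᵤ⇒∣ (ℕ.1∣ ∣ b ∣)
  prime^∣-cancelˡ {p} a {b} pp p∤a (suc j) pʲ⁺¹∣ab
    with euclidsLemmaℤ a b pp (ℤ.∣-trans (ℤ.∣m⇒∣m*n ((+ p) ^ j) ℤ.∣-refl) pʲ⁺¹∣ab)
  ... | inj₁ p∣a = contradiction p∣a p∤a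
  ... | inj₂ (ℤ.divides b′ refl) =
    subst ((+ p) ^ suc j ℤ.∣_) (ℤ.*-comm (+ p) b′) (ℤ.*-monoʳ-∣ (+ p) pʲ∣b′)
    where
    instance _ = prime⇒nonZero pp
    regroup : ∀ a b′ q → a * (b′ * q) ≡ q * (a * b′)
    regroup = solve-∀
    pʲ∣b′ : (+ p) ^ j ℤ.∣ b′
    pʲ∣b′ = prime^∣-cancelˡ a pp p∤a j
      (ℤ.*-cancelˡ-∣ (+ p) (subst (_ ℤ.∣_) (regroup a b′ (+ p)) pʲ⁺¹∣ab))

  sumFin≡sum : ∀ n (f : Fin n → ℤ) → sumFin n f ≡ sum f
  sumFin≡sum zero    f = refl
  sumFin≡sum (suc n) f = cong (_+_ (f F.zero)) (sumFin≡sum n (f ∘ F.suc))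

  sum-cong-mod : ∀ {n m} {f g : Fin n → ℤ} → (∀ i → f i ≡ g i ⟨mod m ⟩) → sum f ≡ sum g ⟨mod m ⟩
  sum-cong-mod {zero}  f≡g = mod-refl
  sum-cong-mod {suc n} f≡g = mod-+-cong (f≡g F.zero) (sum-cong-mod (f≡g ∘ F.suc))

  sum-cong-mod-init-last : ∀ {n m} {f g : Fin (suc n) → ℤ} →
    (∀ i → f (inject₁ i) ≡ g (inject₁ i) ⟨mod m ⟩) → f (fromℕ n) ≡ g (fromℕ n) ⟨mod m ⟩ →
    sum f ≡ sum g ⟨mod m ⟩
  sum-cong-mod-init-last {f = f} {g} init≡ last≡ = begin
    sum f                                   ≡⟨ sum-init-last f ⟩
    sum (f ∘ inject₁) + f (fromℕ _)         ≈⟨ mod-+-cong (sum-cong-mod init≡) last≡ ⟩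
    sum (g ∘ inject₁) + g (fromℕ _)         ≡⟨ sum-init-last g ⟨
    sum g                                   ∎
    where open ModReasoning _

  sum-neg : ∀ {n} (f : Fin n → ℤ) → sum (λ i → - f i) ≡ - sum f
  sum-neg {zero}  f = refl
  sum-neg {suc n} f = trans (cong (_+_ (- f F.zero)) (sum-neg (f ∘ F.suc)))
                            (sym (ℤ.neg-distrib-+ (f F.zero) (sum (f ∘ F.suc))))

  sum-const-1 : ∀ n → sum {n} (λ _ → + 1) ≡ + n
  sum-const-1 zero    = refl
  sum-const-1 (suc n) = cong (_+_ (+ 1)) (sum-const-1 n)

  sum-affine : ∀ {n} c (f g : Fin n → ℤ) →
    sum (λ i → f i + c * (g i - f i)) ≡ sum f + c * (sum g - sum f)
  sum-affine {zero}  c f g = collapse c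
    where
    collapse : ∀ c → + 0 ≡ + 0 + c * (+ 0 - + 0)
    collapse = solve-∀
  sum-affine {suc n} c f g = trans (cong (_+_ (f F.zero + c * (g F.zero - f F.zero)))
                                         (sum-affine c (f ∘ F.suc) (g ∘ F.suc)))
                                   (regroup c (f F.zero) (g F.zero) _ _)
    where
    regroup : ∀ c a b x y → a + c * (b - a) + (x + c * (y - x)) ≡ a + x + c * (b + y - (a + x))
    regroup = solve-∀

  [1+n]C2≡n+nC2 : ∀ n → suc n C 2 ≡ n ℕ.+ n C 2
  [1+n]C2≡n+nC2 n = begin
    suc n C 2       ≡⟨ nCk+nC[k+1]≡[n+1]C[k+1] n 1 ⟨
    n C 1 ℕ.+ n C 2 ≡⟨ cong (ℕ._+ n C 2) (nC1≡n n) ⟩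
    n ℕ.+ n C 2     ∎
    where open ≡-Reasoning

  [1+2h]C2≡[1+2h]*h : ∀ h → suc (h ℕ.+ h) C 2 ≡ suc (h ℕ.+ h) ℕ.* h
  [1+2h]C2≡[1+2h]*h zero    = refl
  [1+2h]C2≡[1+2h]*h (suc h) = begin
    suc (suc h ℕ.+ suc h) C 2                ≡⟨ cong (λ k → suc k C 2) (ℕ.+-suc (suc h) h) ⟩
    suc (suc (suc n)) C 2                    ≡⟨ [1+n]C2≡n+nC2 (suc (suc n)) ⟩
    suc (suc n) ℕ.+ suc (suc n) C 2          ≡⟨ cong (suc (suc n) ℕ.+_) ([1+n]C2≡n+nC2 (suc n)) ⟩
    suc (suc n) ℕ.+ (suc n ℕ.+ suc n C 2)
      ≡⟨ cong (λ c → suc (suc n) ℕ.+ (suc n ℕ.+ c)) ([1+2h]C2≡[1+2h]*h h) ⟩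
    suc (suc n) ℕ.+ (suc n ℕ.+ suc n ℕ.* h)  ≡⟨ expand h ⟩
    suc (suc h ℕ.+ suc h) ℕ.* suc h          ∎
    where
    open ≡-Reasoning
    n = h ℕ.+ h
    expand : ∀ h → suc (suc (h ℕ.+ h)) ℕ.+ (suc (h ℕ.+ h) ℕ.+ suc (h ℕ.+ h) ℕ.* h)
                 ≡ suc (suc h ℕ.+ suc h) ℕ.* suc h
    expand = ℕ.solve-∀

  binomial-linear : ∀ b d n → (b + d) ^ suc n ≡ b ^ suc n + + suc n * d * b ^ n ⟨mod d * d ⟩
  binomial-linear b d zero    = mod-reflexive (expand b d)
    where
    expand : ∀ b d → (b + d) * + 1 ≡ b * + 1 + + 1 * d * + 1
    expand = solve-∀
  binomial-linear b d (suc n) = begin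
    (b + d) * (b + d) ^ suc n                               ≈⟨ mod-*-congˡ (b + d) (binomial-linear b d n) ⟩
    (b + d) * (b * B + s * d * B)                           ≡⟨ expand b d B s ⟩
    b * (b * B) + (+ 1 + s) * d * (b * B) + d * d * (s * B) ≈⟨ mod-+-∣ (m∣m*n (d * d) (s * B)) ⟩
    b * (b * B) + (+ 1 + s) * d * (b * B)                   ∎
    where
    open ModReasoning (d * d)
    B = b ^ n
    s = + suc n
    expand : ∀ b d B s → (b + d) * (b * B + s * d * B)
                       ≡ b * (b * B) + (+ 1 + s) * d * (b * B) + d * d * (s * B)
    expand = solve-∀

  binomial-quadratic : ∀ d n →
    (+ 1 + d) ^ n ≡ + 1 + + n * d + + (n C 2) * (d * d) ⟨mod d * d * d ⟩
  binomial-quadratic d zero    = mod-reflexive (expand d)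
    where
    expand : ∀ d → + 1 ≡ + 1 + + 0 * d + + 0 * (d * d)
    expand = solve-∀
  binomial-quadratic d (suc n) = begin
    (+ 1 + d) * (+ 1 + d) ^ n                               ≈⟨ mod-*-congˡ (+ 1 + d) (binomial-quadratic d n) ⟩
    (+ 1 + d) * (+ 1 + s * d + c * (d * d))                 ≡⟨ expand d s c ⟩
    + 1 + (+ 1 + s) * d + (s + c) * (d * d) + d * d * d * c ≈⟨ mod-+-∣ (m∣m*n (d * d * d) c) ⟩
    + 1 + (+ 1 + s) * d + (s + c) * (d * d)                 ≡⟨ cong (λ c′ → + 1 + (+ 1 + s) * d + c′ * (d * d)) c₂≡s+c ⟨
    + 1 + + suc n * d + + (suc n C 2) * (d * d)             ∎
    where
    open ModReasoning (d * d * d)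
    s = + n
    c = + (n C 2)
    c₂≡s+c : + (suc n C 2) ≡ s + c
    c₂≡s+c = trans (cong +_ ([1+n]C2≡n+nC2 n)) (ℤ.pos-+ n (n C 2))
    expand : ∀ d s c → (+ 1 + d) * (+ 1 + s * d + c * (d * d))
                     ≡ + 1 + (+ 1 + s) * d + (s + c) * (d * d) + d * d * d * c
    expand = solve-∀

  ^p-lift : ∀ p {k a b} → a ≡ b ⟨mod (+ p) ^ suc k ⟩ → a ^ p ≡ b ^ p ⟨mod (+ p) ^ suc (suc k) ⟩
  ^p-lift zero    _ = mod-refl
  ^p-lift (suc n) {k} {a} {b} (mod-intro Q∣d) = begin
    a ^ suc n                 ≡⟨ cong (_^ suc n) (split a b) ⟩
    (b + d) ^ suc n           ≈⟨ mod-weaken qQ∣d² (binomial-linear b d n) ⟩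
    b ^ suc n + q * d * b ^ n ≈⟨ mod-+-∣ (ℤ.∣m⇒∣m*n (b ^ n) (ℤ.*-monoʳ-∣ q Q∣d)) ⟩
    b ^ suc n                 ∎
    where
    open ModReasoning ((+ suc n) ^ suc (suc k))
    q = + suc n
    d = a - b
    qQ∣d² : q * q ^ suc k ℤ.∣ d * d
    qQ∣d² = *-pres-∣ (ℤ.∣-trans (m∣m*n q (q ^ k)) Q∣d) Q∣d
    split : ∀ a b → a ≡ b + (a - b)
    split = solve-∀

  teichmüller-unique : ∀ p {N a b} → a ≡ b ⟨mod + p ⟩ →
    a ^ p ≡ a ⟨mod (+ p) ^ N ⟩ → b ^ p ≡ b ⟨mod (+ p) ^ N ⟩ → a ≡ b ⟨mod (+ p) ^ N ⟩
  teichmüller-unique p {zero}      _   _      _      = mod-intro (ℤ.∣ᵤ⇒∣ (ℕ.1∣ _))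
  teichmüller-unique p {suc N} {a} {b} a≡b aᵖ≡a bᵖ≡b = lift-to N ℕ.≤-refl
    where
    weaken : ∀ {k c d} → k ≤ N → c ≡ d ⟨mod (+ p) ^ suc N ⟩ → c ≡ d ⟨mod (+ p) ^ suc k ⟩
    weaken k≤N = mod-weaken (^-monoʳ-∣ (+ p) (s≤s k≤N))
    lift-to : ∀ k → k ≤ N → a ≡ b ⟨mod (+ p) ^ suc k ⟩
    lift-to zero    _   = mod-weaken (ℤ.∣-reflexive (ℤ.*-identityʳ (+ p))) a≡b
    lift-to (suc k) k<N = begin
      a     ≈⟨ mod-sym (weaken k<N aᵖ≡a) ⟩
      a ^ p ≈⟨ ^p-lift p {k} (lift-to k (ℕ.<⇒≤ k<N)) ⟩
      b ^ p ≈⟨ weaken k<N bᵖ≡b ⟩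
      b     ∎
      where open ModReasoning ((+ p) ^ suc (suc k))

  neg-^-odd : ∀ a h → (- a) ^ suc (h ℕ.+ h) ≡ - a ^ suc (h ℕ.+ h)
  neg-^-odd a zero    = flip a
    where
    flip : ∀ a → (- a) * + 1 ≡ - (a * + 1)
    flip = solve-∀
  neg-^-odd a (suc h) rewrite ℕ.+-suc h h = begin
    (- a) * ((- a) * (- a) ^ suc (h ℕ.+ h)) ≡⟨ cong (λ c → (- a) * ((- a) * c)) (neg-^-odd a h) ⟩
    (- a) * ((- a) * - a ^ suc (h ℕ.+ h))   ≡⟨ flip a (a ^ suc (h ℕ.+ h)) ⟩
    - (a * (a * a ^ suc (h ℕ.+ h)))         ∎
    where
    open ≡-Reasoning
    flip : ∀ a c → (- a) * ((- a) * - c) ≡ - (a * (a * c))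
    flip = solve-∀

  0^n≡0 : ∀ {n} → 0 < n → (+ 0) ^ n ≡ + 0
  0^n≡0 (s≤s z≤n) = refl

  module OddModulus (h : ℕ) where

    p : ℕ
    p = suc (h ℕ.+ h)

    q : ℤ
    q = + p

    q^[1+t]∣q^t*[u-1] : ∀ {u} t → u ≡ + 1 ⟨mod q ⟩ → q ^ suc t ℤ.∣ q ^ t * (u - + 1)
    q^[1+t]∣q^t*[u-1] {u} t (mod-intro q∣u-1) =
      subst (ℤ._∣ q ^ t * (u - + 1)) (ℤ.*-comm (q ^ t) q) (ℤ.*-monoʳ-∣ (q ^ t) q∣u-1)

    -- The quadratic binomial term vanishes modulo p^(k+3) because p ∣ p C 2, i.e. p is odd.
    lte-step : ∀ {k u} → u ≡ + 1 ⟨mod q ^ suc k ⟩ →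
               u ^ p ≡ + 1 + q * (u - + 1) ⟨mod q ^ suc (suc (suc k)) ⟩
    lte-step {k} {u} (mod-intro Q∣d) = begin
      u ^ p                                 ≡⟨ cong (_^ p) (split u) ⟩
      (+ 1 + d) ^ p                         ≈⟨ mod-weaken q²Q∣d³ (binomial-quadratic d p) ⟩
      + 1 + q * d + + (p C 2) * (d * d)     ≡⟨ cong (λ c → + 1 + q * d + c * (d * d)) pC2≡q*h ⟩
      + 1 + q * d + q * + h * (d * d)       ≈⟨ mod-+-∣ (*-pres-∣ (m∣m*n q (+ h)) qQ∣d²) ⟩
      + 1 + q * d                           ∎
      where
      open ModReasoning (q ^ suc (suc (suc k)))
      d = u - + 1
      Q = q ^ suc k
      split : ∀ u → u ≡ + 1 + (u - + 1)
      split = solve-∀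
      q∣d : q ℤ.∣ d
      q∣d = ℤ.∣-trans (m∣m*n q (q ^ k)) Q∣d
      qQ∣d² : q * Q ℤ.∣ d * d
      qQ∣d² = *-pres-∣ q∣d Q∣d
      regroup : ∀ q Q → q * (q * Q) ≡ q * Q * q
      regroup = solve-∀
      q²Q∣d³ : q * (q * Q) ℤ.∣ d * d * d
      q²Q∣d³ = subst (ℤ._∣ d * d * d) (sym (regroup q Q)) (*-pres-∣ qQ∣d² q∣d)
      pC2≡q*h : + (p C 2) ≡ q * + h
      pC2≡q*h = trans (cong +_ ([1+2h]C2≡[1+2h]*h h)) (ℤ.pos-* p h)

    ^p^t : ∀ {u} t → u ≡ + 1 ⟨mod q ⟩ →
           u ^ (p ℕ.^ t) ≡ + 1 + q ^ t * (u - + 1) ⟨mod q ^ suc (suc t) ⟩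
    ^p^t {u} zero    _   = mod-reflexive (expand u)
      where
      expand : ∀ u → u * + 1 ≡ + 1 + + 1 * (u - + 1)
      expand = solve-∀
    ^p^t {u} (suc t) u≡1 = begin
      u ^ (p ℕ.* p ℕ.^ t)            ≡⟨ cong (u ^_) (ℕ.*-comm p (p ℕ.^ t)) ⟩
      u ^ (p ℕ.^ t ℕ.* p)            ≡⟨ ℤ.^-*-assoc u (p ℕ.^ t) p ⟨
      v ^ p                          ≈⟨ lte-step {t} v≡1 ⟩
      + 1 + q * (v - + 1)            ≈⟨ mod-+-congˡ (+ 1) (mod-scale q v-1≡D) ⟩
      + 1 + q * (q ^ t * (u - + 1))  ≡⟨ cong (_+_ (+ 1)) (ℤ.*-assoc q (q ^ t) (u - + 1)) ⟨
      + 1 + q ^ suc t * (u - + 1)    ∎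
      where
      open ModReasoning (q ^ suc (suc (suc t)))
      v = u ^ (p ℕ.^ t)
      D = q ^ t * (u - + 1)
      v≡1+D : v ≡ + 1 + D ⟨mod q ^ suc (suc t) ⟩
      v≡1+D = ^p^t t u≡1
      v≡1 : v ≡ + 1 ⟨mod q ^ suc t ⟩
      v≡1 = mod-trans (mod-weaken (^-monoʳ-∣ q (ℕ.n≤1+n (suc t))) v≡1+D)
                      (mod-+-∣ (q^[1+t]∣q^t*[u-1] t u≡1))
      cancel : ∀ D → + 1 + D - + 1 ≡ D
      cancel = solve-∀
      v-1≡D : v - + 1 ≡ D ⟨mod q ^ suc (suc t) ⟩
      v-1≡D = mod-trans (mod-+-congʳ (- + 1) v≡1+D) (mod-reflexive (cancel D))

    ^p^t*m : ∀ {u} t m → u ≡ + 1 ⟨mod q ⟩ →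
             u ^ (p ℕ.^ t ℕ.* m) ≡ + 1 + q ^ t * + m * (u - + 1) ⟨mod q ^ suc (suc t) ⟩
    ^p^t*m {u} t m u≡1 = begin
      u ^ (p ℕ.^ t ℕ.* m)                  ≡⟨ ℤ.^-*-assoc u (p ℕ.^ t) m ⟨
      (u ^ (p ℕ.^ t)) ^ m                  ≈⟨ mod-^-cong m (^p^t t u≡1) ⟩
      (+ 1 + D) ^ m                        ≈⟨ mod-weaken (ℤ.∣m⇒∣m*n D Q∣D²) (binomial-quadratic D m) ⟩
      + 1 + + m * D + + (m C 2) * (D * D)  ≈⟨ mod-+-∣ (ℤ.∣n⇒∣m*n (+ (m C 2)) Q∣D²) ⟩
      + 1 + + m * D                        ≡⟨ cong (_+_ (+ 1)) (regroup (+ m) (q ^ t) (u - + 1)) ⟩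
      + 1 + q ^ t * + m * (u - + 1)        ∎
      where
      open ModReasoning (q ^ suc (suc t))
      D = q ^ t * (u - + 1)
      Q∣D² : q * q ^ suc t ℤ.∣ D * D
      Q∣D² = *-pres-∣ (ℤ.∣-trans (m∣m*n q (q ^ t)) q^[1+t]∣D) q^[1+t]∣D
        where q^[1+t]∣D = q^[1+t]∣q^t*[u-1] t u≡1
      regroup : ∀ m Q x → m * (Q * x) ≡ Q * m * x
      regroup = solve-∀

    unit-^[p-1]≡1 : ∀ {x} → Prime p → x ^ p ≡ x ⟨mod q ⟩ → ¬ (q ℤ.∣ x) →
                    x ^ (h ℕ.+ h) ≡ + 1 ⟨mod q ⟩
    unit-^[p-1]≡1 {x} pp (mod-intro q∣xᵖ-x) q∤x
      with euclidsLemmaℤ x (x ^ (h ℕ.+ h) - + 1) pp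
             (subst (q ℤ.∣_) (factor x (x ^ (h ℕ.+ h))) q∣xᵖ-x)
      where
      factor : ∀ x u → x * u - x ≡ x * (u - + 1)
      factor = solve-∀
    ... | inj₁ q∣x   = contradiction q∣x q∤x
    ... | inj₂ q∣u-1 = mod-intro q∣u-1

    module _ {x} (pp : Prime p) (xᵖ≡x : x ^ p ≡ x ⟨mod q ⟩) (q∤x : ¬ (q ℤ.∣ x)) (t m : ℕ) where

      private
        e : ℕ
        e = (h ℕ.+ h) ℕ.* (p ℕ.^ t ℕ.* m)

        M : ℤ
        M = q ^ t * + m

      unit-^e : x ^ e ≡ + 1 + M * (x ^ (h ℕ.+ h) - + 1) ⟨mod q ^ suc (suc t) ⟩
      unit-^e = subst (_≡ + 1 + M * (x ^ (h ℕ.+ h) - + 1) ⟨mod q ^ suc (suc t) ⟩)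
                      (ℤ.^-*-assoc x (h ℕ.+ h) (p ℕ.^ t ℕ.* m))
                      (^p^t*m t m (unit-^[p-1]≡1 pp xᵖ≡x q∤x))

      unit-^[1+e] : x ^ suc e ≡ x + M * (x ^ p - x) ⟨mod q ^ suc (suc t) ⟩
      unit-^[1+e] = mod-trans (mod-*-congˡ x unit-^e) (mod-reflexive (expand x M (x ^ (h ℕ.+ h))))
        where
        expand : ∀ x M u → x * (+ 1 + M * (u - + 1)) ≡ x + M * (x * u - x)
        expand = solve-∀

      unit-^e≡1 : x ^ e ≡ + 1 ⟨mod q ^ suc t ⟩
      unit-^e≡1 = mod-trans (mod-weaken (^-monoʳ-∣ q (ℕ.n≤1+n (suc t))) unit-^e)
        (mod-+-∣ (subst (q ^ suc t ℤ.∣_) (regroup (q ^ t) (+ m) (x ^ (h ℕ.+ h) - + 1))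
          (ℤ.∣m⇒∣m*n (+ m) (q^[1+t]∣q^t*[u-1] t (unit-^[p-1]≡1 pp xᵖ≡x q∤x)))))
        where
        regroup : ∀ Q m d → Q * d * m ≡ Q * m * d
        regroup = solve-∀

  module TeichmüllerSystem (h t : ℕ) (pp : Prime (suc (h ℕ.+ h))) (2<p : 2 ℕ.< suc (h ℕ.+ h))
    (T : Fin (suc (h ℕ.+ h)) → ℤ) (T-lift : ∀ μ → IsTeichLiftMod (suc (h ℕ.+ h)) (t ℕ.+ 2) μ (T μ))
    where

    open OddModulus h

    N : ℕ
    N = suc (suc t)

    T≡μ : ∀ μ → T μ ≡ + toℕ μ ⟨mod q ⟩
    T≡μ μ = [mod]⇒⟨mod⟩ (proj₁ (T-lift μ))

    Tᵖ≡T : ∀ μ → T μ ^ p ≡ T μ ⟨mod q ^ N ⟩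
    Tᵖ≡T μ = subst (T μ ^ p ≡ T μ ⟨mod_⟩) (trans (pos-^ p (t ℕ.+ 2)) (cong (q ^_) (ℕ.+-comm t 2)))
                   ([mod]⇒⟨mod⟩ (proj₂ (T-lift μ)))

    T-unique : ∀ μ {a} → a ≡ + toℕ μ ⟨mod q ⟩ → a ^ p ≡ a ⟨mod q ^ N ⟩ → T μ ≡ a ⟨mod q ^ N ⟩
    T-unique μ a≡μ aᵖ≡a = teichmüller-unique p {N} (mod-trans (T≡μ μ) (mod-sym a≡μ)) (Tᵖ≡T μ) aᵖ≡a

    T-zero : T F.zero ≡ + 0 ⟨mod q ^ N ⟩
    T-zero = T-unique F.zero mod-refl mod-refl

    T-last : T (fromℕ (h ℕ.+ h)) ≡ - + 1 ⟨mod q ^ N ⟩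
    T-last = T-unique (fromℕ (h ℕ.+ h))
      (mod-from (ℤ.∣m⇒∣-m ℤ.∣-refl)
        (trans (split (+ (h ℕ.+ h))) (cong (λ n → - + 1 - + n) (sym (toℕ-fromℕ (h ℕ.+ h))))))
      (mod-reflexive (trans (neg-^-odd (+ 1) h) (cong -_ (ℤ.^-zeroˡ p))))
      where
      split : ∀ n → - (+ 1 + n) ≡ - + 1 - n
      split = solve-∀

    T-neg : ∀ μ ν → toℕ μ ℕ.+ toℕ ν ≡ p → T μ ≡ - T ν ⟨mod q ^ N ⟩
    T-neg μ ν μ+ν≡p =
      T-unique μ -Tν≡μ (mod-trans (mod-reflexive (neg-^-odd (T ν) h)) (mod-neg-cong (Tᵖ≡T ν)))
      where
      split : ∀ a b → - (a + b) ≡ - b - a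
      split = solve-∀
      -q≡-ν-μ : - q ≡ - + toℕ ν - + toℕ μ
      -q≡-ν-μ = trans (cong (λ n → - + n) (sym μ+ν≡p))
                      (trans (cong -_ (ℤ.pos-+ (toℕ μ) (toℕ ν))) (split (+ toℕ μ) (+ toℕ ν)))
      -Tν≡μ : - T ν ≡ + toℕ μ ⟨mod q ⟩
      -Tν≡μ = mod-trans (mod-neg-cong (T≡μ ν)) (mod-from (ℤ.∣m⇒∣-m ℤ.∣-refl) -q≡-ν-μ)

    sum-T : sum T ≡ + 0 ⟨mod q ^ N ⟩
    sum-T = mod-+-cong T-zero S≡0
      where
      S = sum (T ∘ F.suc)
      pairs-to-p : ∀ i → toℕ (F.suc (opposite i)) ℕ.+ toℕ (F.suc i) ≡ p
      pairs-to-p i = cong suc (trans (cong (ℕ._+ suc (toℕ i)) (opposite-prop i))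
                                     (ℕ.m∸n+n≡m (toℕ<n i)))
      S≡-S : S ≡ - S ⟨mod q ^ N ⟩
      S≡-S = begin
        S                                   ≡⟨ sum-permute (T ∘ F.suc) Perm.reverse ⟩
        sum (λ i → T (F.suc (opposite i))) ≈⟨ sum-cong-mod (λ i → T-neg _ _ (pairs-to-p i)) ⟩
        sum (λ i → - T (F.suc i))          ≡⟨ sum-neg (T ∘ F.suc) ⟩
        - S                                 ∎
        where open ModReasoning (q ^ N)
      double : ∀ S → S - - S ≡ + 2 * S
      double = solve-∀
      q∤2 : ¬ (q ℤ.∣ + 2)
      q∤2 q∣2 = ℕ.<⇒≱ 2<p (ℕ.∣⇒≤ (ℤ.∣⇒∣ᵤ q∣2))
      S≡0 : S ≡ + 0 ⟨mod q ^ N ⟩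
      S≡0 = mod-from (prime^∣-cancelˡ (+ 2) pp q∤2 N
                      (subst (q ^ N ℤ.∣_) (double S) (divides-difference S≡-S)))
                   (sym (ℤ.+-identityʳ S))

    -- fromℕ (h + h) is the residue −1, the only μ at which x μ is not a unit.
    x : Fin p → ℤ
    x μ = + 1 + T μ

    x-last≡0 : x (fromℕ (h ℕ.+ h)) ≡ + 0 ⟨mod q ^ N ⟩
    x-last≡0 = mod-+-congˡ (+ 1) T-last

    x∘inject₁≡T∘suc : ∀ i → x (inject₁ i) ≡ T (F.suc i) ⟨mod q ⟩
    x∘inject₁≡T∘suc i = mod-trans (mod-+-congˡ (+ 1) (T≡μ (inject₁ i)))
      (mod-trans (mod-reflexive (cong (λ n → + suc n) (toℕ-inject₁ i))) (mod-sym (T≡μ (F.suc i))))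

    x∘inject₁ᵖ≡T∘suc : ∀ i → x (inject₁ i) ^ p ≡ T (F.suc i) ⟨mod q ^ 2 ⟩
    x∘inject₁ᵖ≡T∘suc i = mod-trans
      (^p-lift p {0} (mod-weaken (ℤ.∣-reflexive (ℤ.*-identityʳ q)) (x∘inject₁≡T∘suc i)))
      (mod-weaken (^-monoʳ-∣ q {2} {N} (s≤s (s≤s z≤n))) (Tᵖ≡T (F.suc i)))

    x∘inject₁ᵖ≡x∘inject₁ : ∀ i → x (inject₁ i) ^ p ≡ x (inject₁ i) ⟨mod q ⟩
    x∘inject₁ᵖ≡x∘inject₁ i = begin
      x (inject₁ i) ^ p  ≈⟨ mod-^-cong p (x∘inject₁≡T∘suc i) ⟩
      T (F.suc i) ^ p    ≈⟨ mod-weaken (m∣m*n q (q ^ suc t)) (Tᵖ≡T (F.suc i)) ⟩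
      T (F.suc i)        ≈⟨ mod-sym (x∘inject₁≡T∘suc i) ⟩
      x (inject₁ i)      ∎
      where open ModReasoning q

    q∤x∘inject₁ : ∀ i → ¬ (q ℤ.∣ x (inject₁ i))
    q∤x∘inject₁ i q∣x = ℕ.<⇒≱ (s≤s (toℕ<n i)) (ℕ.∣⇒≤ (ℤ.∣⇒∣ᵤ q∣1+i))
      where
      recover : ∀ a b → b - a + a ≡ b
      recover = solve-∀
      q∣1+i : q ℤ.∣ + suc (toℕ i)
      q∣1+i = subst (q ℤ.∣_) (recover (x (inject₁ i)) _)
        (ℤ.∣m∣n⇒∣m+n (divides-difference (mod-trans (mod-sym (T≡μ (F.suc i)))
                                                    (mod-sym (x∘inject₁≡T∘suc i)))) q∣x)

    sum-x : sum x ≡ q ⟨mod q ^ N ⟩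
    sum-x = begin
      sum x                         ≡⟨ ∑-distrib-+ (λ _ → + 1) T ⟩
      sum {p} (λ _ → + 1) + sum T   ≡⟨ cong (_+ sum T) (sum-const-1 p) ⟩
      q + sum T                     ≈⟨ mod-+-congˡ q sum-T ⟩
      q + + 0                       ≡⟨ ℤ.+-identityʳ q ⟩
      q                             ∎
      where open ModReasoning (q ^ N)

    -- (x μ)^p ≡ [μ + 1] (mod p²), and μ ↦ μ + 1 permutes the residues.
    sum-xᵖ : sum (λ μ → x μ ^ p) ≡ + 0 ⟨mod q ^ 2 ⟩
    sum-xᵖ = begin
      sum (λ μ → x μ ^ p)                                     ≡⟨ sum-init-last (λ μ → x μ ^ p) ⟩
      sum (λ i → x (inject₁ i) ^ p) + x (fromℕ (h ℕ.+ h)) ^ p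
        ≈⟨ mod-+-cong (sum-cong-mod x∘inject₁ᵖ≡T∘suc) (weaken (mod-^-cong p x-last≡0)) ⟩
      sum (T ∘ F.suc) + + 0                                   ≈⟨ mod-+-congˡ S (mod-sym (weaken T-zero)) ⟩
      sum (T ∘ F.suc) + T F.zero                              ≡⟨ ℤ.+-comm _ (T F.zero) ⟩
      sum T                                                   ≈⟨ weaken sum-T ⟩
      + 0                                                     ∎
      where
      open ModReasoning (q ^ 2)
      S = sum (T ∘ F.suc)
      weaken : ∀ {a b} → a ≡ b ⟨mod q ^ N ⟩ → a ≡ b ⟨mod q ^ 2 ⟩
      weaken = mod-weaken (^-monoʳ-∣ q {2} {N} (s≤s (s≤s z≤n)))

    module _ (m : ℕ) where

      private
        e : ℕ
        e = (h ℕ.+ h) ℕ.* (p ℕ.^ t ℕ.* m)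

        M : ℤ
        M = q ^ t * + m

      x-last^[1+e]≡affine : let l = fromℕ (h ℕ.+ h) in
                            x l ^ suc e ≡ x l + M * (x l ^ p - x l) ⟨mod q ^ N ⟩
      x-last^[1+e]≡affine = mod-trans (mod-^-cong (suc e) x-last≡0) (mod-sym (mod-trans
        (mod-+-cong x-last≡0 (mod-*-congˡ M (mod---cong (mod-^-cong p x-last≡0) x-last≡0)))
        (mod-reflexive (collapse M))))
        where
        collapse : ∀ M → + 0 + M * (+ 0 - + 0) ≡ + 0
        collapse = solve-∀

      sum-x^[1+e]≡affine :
        sum (λ μ → x μ ^ suc e) ≡ sum x + M * (sum (λ μ → x μ ^ p) - sum x) ⟨mod q ^ N ⟩
      sum-x^[1+e]≡affine = mod-trans
        (sum-cong-mod-init-last {f = λ μ → x μ ^ suc e} {g = λ μ → x μ + M * (x μ ^ p - x μ)}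
          (λ i → unit-^[1+e] pp (x∘inject₁ᵖ≡x∘inject₁ i) (q∤x∘inject₁ i) t m) x-last^[1+e]≡affine)
        (mod-reflexive (sum-affine M x (λ μ → x μ ^ p)))

      sum-x^[1+e] : sum (λ μ → x μ ^ suc e) ≡ + (suc e ℕ.* p) ⟨mod q ^ N ⟩
      sum-x^[1+e] = begin
        sum (λ μ → x μ ^ suc e)                    ≈⟨ sum-x^[1+e]≡affine ⟩
        sum x + M * (sum (λ μ → x μ ^ p) - sum x)
          ≈⟨ mod-+-cong sum-x (mod-weaken q^N∣M*q² (mod-scale M Σxᵖ-Σx≡-q)) ⟩
        q + M * (+ 0 - q)
          ≈⟨ mod-sym (mod-from (m∣m*n (q ^ N) (+ m)) (expand (+ (h ℕ.+ h)) (q ^ t) (+ m))) ⟩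
        (+ 1 + + (h ℕ.+ h) * M) * q                ≡⟨ rp≡ ⟨
        + (suc e ℕ.* p)                            ∎
        where
        open ModReasoning (q ^ N)
        Σxᵖ-Σx≡-q : sum (λ μ → x μ ^ p) - sum x ≡ + 0 - q ⟨mod q ^ 2 ⟩
        Σxᵖ-Σx≡-q = mod---cong sum-xᵖ (mod-weaken (^-monoʳ-∣ q {2} {N} (s≤s (s≤s z≤n))) sum-x)
        regroup : ∀ q Qt m → Qt * m * (q * (q * + 1)) ≡ q * (q * Qt) * m
        regroup = solve-∀
        q^N∣M*q² : q ^ N ℤ.∣ M * q ^ 2
        q^N∣M*q² = subst (q ^ N ℤ.∣_) (sym (regroup q (q ^ t) (+ m))) (m∣m*n (q ^ N) (+ m))
        expand : ∀ n Qt m → (+ 1 + n) * ((+ 1 + n) * Qt) * m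
                          ≡ (+ 1 + n * (Qt * m)) * (+ 1 + n) - (+ 1 + n + Qt * m * (+ 0 - (+ 1 + n)))
        expand = solve-∀
        rp≡ : + (suc e ℕ.* p) ≡ (+ 1 + + (h ℕ.+ h) * M) * q
        rp≡ = trans (ℤ.pos-* (suc e) p)
                    (cong (λ c → (+ 1 + c) * q)
                          (trans (ℤ.pos-* (h ℕ.+ h) _)
                                 (cong (+ (h ℕ.+ h) *_) (trans (ℤ.pos-* (p ℕ.^ t) m)
                                                               (cong (_* + m) (pos-^ p t))))))

      sum-x^e : 0 < e → sum (λ μ → x μ ^ e) ≡ + (h ℕ.+ h) ⟨mod q ^ suc t ⟩
      sum-x^e 0<e = begin
        sum (λ μ → x μ ^ e)                                     ≡⟨ sum-init-last (λ μ → x μ ^ e) ⟩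
        sum (λ i → x (inject₁ i) ^ e) + x (fromℕ (h ℕ.+ h)) ^ e ≈⟨ mod-+-cong (sum-cong-mod units) last ⟩
        sum {h ℕ.+ h} (λ _ → + 1) + (+ 0) ^ e                   ≡⟨ cong₂ _+_ (sum-const-1 (h ℕ.+ h)) (0^n≡0 0<e) ⟩
        + (h ℕ.+ h) + + 0                                       ≡⟨ ℤ.+-identityʳ _ ⟩
        + (h ℕ.+ h)                                             ∎
        where
        open ModReasoning (q ^ suc t)
        units : ∀ i → x (inject₁ i) ^ e ≡ + 1 ⟨mod q ^ suc t ⟩
        units i = unit-^e≡1 pp (x∘inject₁ᵖ≡x∘inject₁ i) (q∤x∘inject₁ i) t m
        last : x (fromℕ (h ℕ.+ h)) ^ e ≡ (+ 0) ^ e ⟨mod q ^ suc t ⟩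
        last = mod-weaken (^-monoʳ-∣ q {suc t} {N} (ℕ.n≤1+n _)) (mod-^-cong e x-last≡0)

  prime>2⇒odd : ∀ {p} → Prime p → 2 ℕ.< p → Σ ℕ λ h → p ≡ suc (h ℕ.+ h)
  prime>2⇒odd {p} pp 2<p = by-parity (p % 2) (m%n<n p 2) (m≡m%n+[m/n]*n p 2)
    where
    double : ∀ h → h ℕ.* 2 ≡ h ℕ.+ h
    double = ℕ.solve-∀
    by-parity : ∀ ρ → ρ ℕ.< 2 → p ≡ ρ ℕ.+ p / 2 ℕ.* 2 → Σ ℕ λ h → p ≡ suc (h ℕ.+ h)
    by-parity zero    _ p≡ with prime⇒irreducible pp (ℕ.divides (p / 2) p≡)
    ... | inj₁ ()
    ... | inj₂ refl = contradiction 2<p (ℕ.<-irrefl refl)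
    by-parity (suc zero) _ p≡ = p / 2 , trans p≡ (cong suc (double (p / 2)))
    by-parity (suc (suc _)) (s≤s (s≤s ())) _

  exponent-shape : ∀ {p t e} → Prime p → 2 ℕ.< p → (p ∸ 1) ℕ.∣ e → p ℕ.^ t ℕ.∣ e →
                   Σ ℕ λ m → e ≡ (p ∸ 1) ℕ.* (p ℕ.^ t ℕ.* m)
  exponent-shape {p@(suc (suc (suc _)))} {t} pp _ (ℕ.divides k refl) pᵗ∣e
    with ℤ.∣⇒∣ᵤ (prime^∣-cancelˡ (+ (p ∸ 1)) pp p∤p-1 t pᵗ∣[p-1]*k)
    where
    p∤p-1 : ¬ (+ p ℤ.∣ + (p ∸ 1))
    p∤p-1 p∣p-1 = ℕ.<⇒≱ (ℕ.n<1+n (p ∸ 1)) (ℕ.∣⇒≤ (ℤ.∣⇒∣ᵤ p∣p-1))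
    pᵗ∣[p-1]*k : (+ p) ^ t ℤ.∣ + (p ∸ 1) * + k
    pᵗ∣[p-1]*k = subst₂ ℤ._∣_ (pos-^ p t) (trans (cong +_ (ℕ.*-comm k (p ∸ 1))) (ℤ.pos-* (p ∸ 1) k))
                         (ℤ.∣ᵤ⇒∣ pᵗ∣e)
  ... | pᵗ∣k with subst (ℕ._∣ k) (cong ∣_∣ (sym (pos-^ p t))) pᵗ∣k
  ...   | ℕ.divides m refl = m , reshape m (p ℕ.^ t) (p ∸ 1)
    where
    reshape : ∀ m P n → m ℕ.* P ℕ.* n ≡ n ℕ.* (P ℕ.* m)
    reshape = ℕ.solve-∀
  exponent-shape {suc (suc zero)} _ (s≤s (s≤s ())) _ _

  sum⟨mod⟩⇒sumFin[mod] : ∀ {n p k k′ b} (f : Fin n → ℤ) → k ≡ k′ →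
    sum f ≡ b ⟨mod (+ p) ^ k ⟩ → sumFin n f ≡ b [mod p ℕ.^ k′ ]
  sum⟨mod⟩⇒sumFin[mod] {n} {p} {k} {b = b} f refl sum≡b =
    ⟨mod⟩⇒[mod] (subst₂ (λ s m → s ≡ b ⟨mod m ⟩) (sym (sumFin≡sum n f)) (sym (pos-^ p k)) sum≡b)

open import Defs
open import Data.Nat using (ℕ; _<_; _∸_; _^_; _+_; _*_)
open import Data.Nat.Divisibility using (_∣_)
open import Data.Nat.Primality using (Prime)
open import Data.Fin using (Fin)
open import Data.Integer using (ℤ; +_) renaming (_+_ to _+ℤ_; _^_ to _^ℤ_; _-_ to _-ℤ_)
open import Data.Product using (_×_)

open import Data.Nat using (suc; s≤s)
open import Data.Nat.Properties using (+-comm)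
open import Data.Product using (_,_)
open import Relation.Binary.PropositionalEquality using (refl)

lemma2p4 : (p r t : ℕ) → Prime p → 2 < p → 1 < r → (p ∸ 1) ∣ (r ∸ 1)
  → IsValuation p (r ∸ 1) t
  → (T : Fin p → ℤ) → ((μ : Fin p) → IsTeichLiftMod p (t + 2) μ (T μ))
  → (sumFin p (λ μ → (+ 1 +ℤ T μ) ^ℤ r) ≡ + (r * p) [mod p ^ (t + 2) ])
    × (sumFin p (λ μ → (+ 1 +ℤ T μ) ^ℤ (r ∸ 1)) ≡ + (p ∸ 1) [mod p ^ (t + 1) ])
lemma2p4 p (suc e) t pp 2<p (s≤s 0<e) p-1∣e (pᵗ∣e , _) T T-lift
  with prime>2⇒odd pp 2<p
... | h , refl with exponent-shape {t = t} pp 2<p p-1∣e pᵗ∣e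
... | m , refl =
    sum⟨mod⟩⇒sumFin[mod] (λ μ → x μ ^ℤ suc e) (+-comm 2 t) (sum-x^[1+e] m)
  , sum⟨mod⟩⇒sumFin[mod] (λ μ → x μ ^ℤ e) (+-comm 1 t) (sum-x^e m 0<e)
  where open TeichmüllerSystem h t pp 2<p T T-lift
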